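{- Let $n,d$ be positive integers and $\lambda,\mu\in\mathcal{L}_d(C_n)$. Suppose there exists $g\in S_d$ with $g^{ -1}\left(\prod_{i=0}^{n-1}\lambda(i^+)\right)g=\prod_{i=0}^{n-1}\mu(i^+)$. Then $C_{n,\lambda}\cong C_{n,\mu}$.
   Context: $C_n$ is the (multi)graph with vertex set $\mathbb{Z}/n\mathbb{Z}$ and edges $i^+$ joining $i$ to $i+1$. Permutations in $S_d$ act on $[d]$ on the right, $j\mapsto j^\sigma$, with $j^{\sigma\tau}=(j^\sigma)^\tau$; products over $i$ are taken in the order $i=0,\dots,n-1$. An $S_d$-labeling $\lambda\in\mathcal{L}_d(C_n)$ assigns a permutation $\lambda(i^+)\in S_d$ to each edge $i^+$ (the reverse orientation labeled by the inverse). The cover $C_{n,\lambda}$ has vertex set $\mathbb{Z}/n\mathbb{Z}\times[d]$ and, for each $i$ and $j\in[d]$, an edge from $(i,j)$ to $(i+1,j^{\lambda(i^+)})$. $\cong$ denotes graph isomorphism. -}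

module Defs where

open import Data.Nat using (ℕ; zero; suc; NonZero)
open import Data.Nat.DivMod using (_%_; m%n<n)
open import Data.Fin using (Fin; zero; suc; toℕ; fromℕ<)
open import Data.Fin.Permutation using (Permutation′; id; _∘ₚ_; _⟨$⟩ʳ_)
open import Data.Product using (_×_; _,_; proj₁; proj₂)
open import Data.Sum using (_⊎_)
open import Function using (_∘_)
open import Function.Bundles using (_↔_; Inverse)
open import Relation.Binary.PropositionalEquality using (_≡_)

-- Symmetric group S_d acting on [d] = Fin d on the right:
-- j ^ σ = σ ⟨$⟩ʳ j, and (σ ∘ₚ τ) applies σ first, i.e. σ ∘ₚ τ = στ.
S : ℕ → Set
S d = Permutation′ d

next : ∀ {n} .{{_ : NonZero n}} → Fin n → Fin n
next {n} i = fromℕ< (m%n<n (suc (toℕ i)) n)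

Labeling : ℕ → ℕ → Set
Labeling n d = Fin n → S d

prod : ∀ {n d} → (Fin n → S d) → S d
prod {zero}  l = id
prod {suc n} l = l zero ∘ₚ prod (l ∘ suc)

-- Undirected multigraphs (loops and multiple edges allowed): each edge
-- has a pair of endpoints; the chosen orientation is irrelevant for
-- isomorphism.
record Graph : Set₁ where
  field
    V    : Set
    E    : Set
    ends : E → V × V

open Graph

SameEnds : ∀ {A : Set} → A × A → A × A → Set
SameEnds (a , b) (c , d) = ((a ≡ c) × (b ≡ d)) ⊎ ((a ≡ d) × (b ≡ c))

record _≅_ (G H : Graph) : Set where
  field
    vmap : V G ↔ V H
    emap : E G ↔ E H
    incidence : ∀ e →
      SameEnds (ends H (Inverse.to emap e))
               (Inverse.to vmap (proj₁ (ends G e)) , Inverse.to vmap (proj₂ (ends G e)))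

cover : ∀ n d .{{_ : NonZero n}} → Labeling n d → Graph
cover n d l = record
  { V    = Fin n × Fin d
  ; E    = Fin n × Fin d
  ; ends = λ { (i , j) → ((i , j) , (next i , l i ⟨$⟩ʳ j)) }
  }

-- The monodromy of the cover C_{n,λ} around the cycle is the ordered
-- product ∏ λ(i⁺).  The proof "gauges" the cover fibre by fibre.
--
--  * Switching lemma: if a family a_i ∈ S_d satisfies
--    λ(i⁺) a_{i+1} = a_i μ(i⁺) for every edge i⁺, then relabelling the
--    fibre over i by a_i, i.e. (i , j) ↦ (i , j^{a_i}), maps edges to edges
--    and is an isomorphism C_{n,λ} ≅ C_{n,μ} (on vertices and on edges).
--  * Prefix products π_i = λ(0⁺)⋯λ((i-1)⁺) satisfy π_{i+1} = π_i λ(i⁺)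
--    and π_{n-1} λ((n-1)⁺) = ∏ λ.
--  * Given g with g⁻¹ (∏ λ) g = ∏ μ, the family a_i = π_i⁻¹ g π'_i
--    (π' the prefix products of μ) is a switching: on interior edges
--    this is the prefix recursion, and on the closing edge (n-1)⁺,
--    where next wraps around to 0 and a_0 = g, it is the conjugacy.
module Submission where

open import Defs
open import Data.Nat using (ℕ; NonZero; suc; s≤s)
open import Data.Nat.DivMod using (_%_; m<n⇒m%n≡m; n%n≡0)
open import Data.Fin using (Fin; zero; suc; toℕ; fromℕ; inject₁)
open import Data.Fin.Properties using (toℕ-fromℕ<; toℕ-injective; toℕ-inject₁; toℕ<n; toℕ-fromℕ)
open import Data.Fin.Relation.Unary.Top using (view; ‵fromℕ; ‵inject₁)
open import Data.Fin.Permutation using (_≈_; _∘ₚ_; flip; _⟨$⟩ʳ_; _⟨$⟩ˡ_; inverseˡ; inverseʳ; id)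
open import Data.Product using (Σ; _,_; _×_)
open import Data.Sum using (inj₁)
open import Function using (_∘_)
open import Function.Bundles using (_↔_; mk↔ₛ′)
open import Relation.Binary.PropositionalEquality

next-inject₁ : ∀ {k} (i : Fin k) → next {suc k} (inject₁ i) ≡ suc i
next-inject₁ {k} i = toℕ-injective (begin
  toℕ (next {suc k} (inject₁ i)) ≡⟨ toℕ-fromℕ< _ ⟩
  suc (toℕ (inject₁ i)) % suc k  ≡⟨ cong (λ t → suc t % suc k) (toℕ-inject₁ i) ⟩
  suc (toℕ i) % suc k            ≡⟨ m<n⇒m%n≡m (s≤s (toℕ<n i)) ⟩
  suc (toℕ i)                    ∎)
  where open ≡-Reasoning

next-fromℕ : ∀ k → next {suc k} (fromℕ k) ≡ zero
next-fromℕ k = toℕ-injective (begin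
  toℕ (next {suc k} (fromℕ k)) ≡⟨ toℕ-fromℕ< _ ⟩
  suc (toℕ (fromℕ k)) % suc k  ≡⟨ cong (λ t → suc t % suc k) (toℕ-fromℕ k) ⟩
  suc k % suc k                ≡⟨ n%n≡0 (suc k) ⟩
  0                            ∎)
  where open ≡-Reasoning

inverse-unique : ∀ {d} (σ : S d) {y z} → σ ⟨$⟩ʳ z ≡ y → σ ⟨$⟩ˡ y ≡ z
inverse-unique σ refl = inverseˡ σ

inverse-cancelʳ : ∀ {d} (σ τ ρ : S d) → σ ≈ τ ∘ₚ ρ → ∀ j → σ ⟨$⟩ˡ (ρ ⟨$⟩ʳ j) ≡ τ ⟨$⟩ˡ j
inverse-cancelʳ σ τ ρ σ≈τρ j =
  inverse-unique σ (trans (σ≈τρ (τ ⟨$⟩ˡ j)) (cong (ρ ⟨$⟩ʳ_) (inverseʳ τ)))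

conjugate⇒intertwines : ∀ {d} (g α β : S d) → (flip g ∘ₚ α) ∘ₚ g ≈ β →
  ∀ j → g ⟨$⟩ʳ (α ⟨$⟩ʳ j) ≡ β ⟨$⟩ʳ (g ⟨$⟩ʳ j)
conjugate⇒intertwines g α β conj j =
  trans (cong (λ y → g ⟨$⟩ʳ (α ⟨$⟩ʳ y)) (sym (inverseˡ g))) (conj (g ⟨$⟩ʳ j))

prefix : ∀ {n d} → (Fin n → S d) → Fin n → S d
prefix l zero    = id
prefix l (suc i) = l zero ∘ₚ prefix (l ∘ suc) i

prefix-step : ∀ {k d} (l : Fin (suc k) → S d) (i : Fin k) →
  prefix l (suc i) ≈ prefix l (inject₁ i) ∘ₚ l (inject₁ i)
prefix-step l zero    j = refl
prefix-step l (suc i) j = prefix-step (l ∘ suc) i (l zero ⟨$⟩ʳ j)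

prefix-last : ∀ {k d} (l : Fin (suc k) → S d) →
  prefix l (fromℕ k) ∘ₚ l (fromℕ k) ≈ prod l
prefix-last {ℕ.zero} l j = refl
prefix-last {suc k}  l j = prefix-last (l ∘ suc) (l zero ⟨$⟩ʳ j)

Switching : ∀ {n d} .{{_ : NonZero n}} → Labeling n d → Labeling n d → (Fin n → S d) → Set
Switching l m a = ∀ i → l i ∘ₚ a (next i) ≈ a i ∘ₚ m i

relabel : ∀ {n d} → (Fin n → S d) → (Fin n × Fin d) ↔ (Fin n × Fin d)
relabel a = mk↔ₛ′ (λ { (i , j) → (i , a i ⟨$⟩ʳ j) }) (λ { (i , j) → (i , a i ⟨$⟩ˡ j) })
  (λ { (i , j) → cong (i ,_) (inverseʳ (a i)) })
  (λ { (i , j) → cong (i ,_) (inverseˡ (a i)) })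

-- Switching lemma: a switching induces C_{n,λ} ≅ C_{n,μ}, by relabelling
-- both vertices and edges; the edge (i , j) lands on (i , j^{a_i}), whose
-- far end (i+1 , (j^{a_i})^{μ(i⁺)}) is the image of (i+1 , j^{λ(i⁺)}).
switching⇒≅ : ∀ {n d} .{{_ : NonZero n}} (l m : Labeling n d) (a : Fin n → S d) →
  Switching l m a → cover n d l ≅ cover n d m
switching⇒≅ l m a switch = record
  { vmap      = relabel a
  ; emap      = relabel a
  ; incidence = λ { (i , j) → inj₁ (refl , cong (next i ,_) (sym (switch i j))) }
  }

module Conjugator {k d : ℕ} (l m : Labeling (suc k) d) (g : S d)
                  (conj : (flip g ∘ₚ prod l) ∘ₚ g ≈ prod m) where

  -- j^{a_i} = ((j^{π_i⁻¹})^g)^{π'_i}; note a_0 = g.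
  a : Fin (suc k) → S d
  a i = flip (prefix l i) ∘ₚ g ∘ₚ prefix m i

  -- Interior edges: the prefix recursions of λ and μ cancel.
  switch-inject₁ : ∀ i → l (inject₁ i) ∘ₚ a (suc i) ≈ a (inject₁ i) ∘ₚ m (inject₁ i)
  switch-inject₁ i j = begin
    prefix m (suc i) ⟨$⟩ʳ (g ⟨$⟩ʳ (prefix l (suc i) ⟨$⟩ˡ (l (inject₁ i) ⟨$⟩ʳ j)))
      ≡⟨ cong (λ y → prefix m (suc i) ⟨$⟩ʳ (g ⟨$⟩ʳ y))
           (inverse-cancelʳ (prefix l (suc i)) (prefix l (inject₁ i)) (l (inject₁ i)) (prefix-step l i) j) ⟩
    prefix m (suc i) ⟨$⟩ʳ (g ⟨$⟩ʳ (prefix l (inject₁ i) ⟨$⟩ˡ j))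
      ≡⟨ prefix-step m i _ ⟩
    m (inject₁ i) ⟨$⟩ʳ (a (inject₁ i) ⟨$⟩ʳ j) ∎
    where open ≡-Reasoning

  -- The closing edge: a_0 = g, and the full products are conjugate by g.
  switch-fromℕ : l (fromℕ k) ∘ₚ a zero ≈ a (fromℕ k) ∘ₚ m (fromℕ k)
  switch-fromℕ j = begin
    g ⟨$⟩ʳ (l (fromℕ k) ⟨$⟩ʳ j)
      ≡⟨ cong (λ x → g ⟨$⟩ʳ (l (fromℕ k) ⟨$⟩ʳ x)) (sym (inverseʳ (prefix l (fromℕ k)))) ⟩
    g ⟨$⟩ʳ (l (fromℕ k) ⟨$⟩ʳ (prefix l (fromℕ k) ⟨$⟩ʳ y))
      ≡⟨ cong (g ⟨$⟩ʳ_) (prefix-last l y) ⟩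
    g ⟨$⟩ʳ (prod l ⟨$⟩ʳ y)
      ≡⟨ conjugate⇒intertwines g (prod l) (prod m) conj y ⟩
    prod m ⟨$⟩ʳ (g ⟨$⟩ʳ y)
      ≡⟨ sym (prefix-last m (g ⟨$⟩ʳ y)) ⟩
    m (fromℕ k) ⟨$⟩ʳ (a (fromℕ k) ⟨$⟩ʳ j) ∎
    where
      open ≡-Reasoning
      y : Fin d
      y = prefix l (fromℕ k) ⟨$⟩ˡ j

  switching : Switching l m a
  switching i with view i
  ... | ‵fromℕ     rewrite next-fromℕ k  = switch-fromℕ
  ... | ‵inject₁ i rewrite next-inject₁ i = switch-inject₁ i

corollary3p4 : (n d : ℕ) .{{_ : NonZero n}} .{{_ : NonZero d}}
    → (l m : Labeling n d)
    → Σ (S d) (λ g → ((flip g ∘ₚ prod l) ∘ₚ g) ≈ prod m)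
    → cover n d l ≅ cover n d m
corollary3p4 (suc k) d l m (g , conj) =
  switching⇒≅ l m (Conjugator.a l m g conj) (Conjugator.switching l m g conj)
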